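{- Let $m\ge3$ be an odd integer and let $n\ge 3$ be an integer that is not a multiple of $m$. Then $(n-1,1)\notin\mathrm{HWP}(C_m[n];m,n)$; that is, the edges of $C_m[n]$ cannot be partitioned into $n-1$ $C_m$-factors and one $C_n$-factor.
   Context: $C_m[n]$ is the lexicographic product of the $m$-cycle with the empty graph on $n$ vertices: vertex set $\mathbb{Z}_m\times\mathbb{Z}_n$, with $(x,i)$ adjacent to $(y,j)$ iff $y=x\pm1$ in $\mathbb{Z}_m$ (any $i,j$). For $k\ge3$ a $C_k$-factor is a spanning subgraph all of whose components are $k$-cycles. $\mathrm{HWP}(G;m,n)$ is the set of pairs $(\alpha,\beta)$ such that the edges of $G$ can be partitioned into $\alpha$ $C_m$-factors and $\beta$ $C_n$-factors. -}

module Defs where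

open import Data.Nat using (ℕ; zero; suc)
open import Data.Nat.DivMod using (_mod_)
open import Data.Fin using (Fin; toℕ)
open import Data.Product using (_×_; Σ; ∃; ∃-syntax; _,_)
open import Data.Sum using (_⊎_; inj₁; inj₂)
open import Relation.Binary.PropositionalEquality using (_≡_)
open import Function.Definitions using (Injective)

next : ∀ {k} → Fin k → Fin k
next {suc k} i = suc (toℕ i) mod (suc k)

V : ℕ → ℕ → Set
V m n = Fin m × Fin n

Adj : (m n : ℕ) → V m n → V m n → Set
Adj m n (x , i) (y , j) = (y ≡ next x) ⊎ (x ≡ next y)

-- A C_k-factor of a graph on vertex set V, given by its t components:
-- t vertex-disjoint k-cycles (cyc p : Fin k → V, injective, consecutive
-- vertices cyc p i, cyc p (i+1 mod k) adjacent) covering every vertex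
-- exactly once.
record CycleFactor (k : ℕ) (W : Set) : Set₁ where
  field
    t     : ℕ
    cyc   : Fin t → Fin k → W
    inj   : ∀ p → Injective _≡_ _≡_ (cyc p)
    cover : ∀ w → ∃[ p ] ∃[ i ] (cyc p i ≡ w)
    disj  : ∀ p q i j → cyc p i ≡ cyc q j → p ≡ q

FEdge : ∀ {k W} → CycleFactor k W → W → W → Set
FEdge F u v = ∃[ p ] ∃[ i ]
  ((cyc p i ≡ u × cyc p (next i) ≡ v) ⊎ (cyc p i ≡ v × cyc p (next i) ≡ u))
  where open CycleFactor F

InF : ∀ {m n α β} → (Fin α → CycleFactor m (V m n)) → (Fin β → CycleFactor n (V m n)) →
      Fin α ⊎ Fin β → V m n → V m n → Set
InF Fm Fn (inj₁ a) u v = FEdge (Fm a) u v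
InF Fm Fn (inj₂ b) u v = FEdge (Fn b) u v

-- (α , β) ∈ HWP(C_m[n]; m, n): the edges of C_m[n] are partitioned into
-- α C_m-factors and β C_n-factors of C_m[n].
record HWPDecomp (m n α β : ℕ) : Set₁ where
  field
    Fm : Fin α → CycleFactor m (V m n)
    Fn : Fin β → CycleFactor n (V m n)
    sub : ∀ j u v → InF Fm Fn j u v → Adj m n u v
    exactlyOne : ∀ u v → Adj m n u v →
      Σ (Fin α ⊎ Fin β) λ j → InF Fm Fn j u v × (∀ j' → InF Fm Fn j' u v → j' ≡ j)

HWP : ℕ → ℕ → ℕ → ℕ → Set₁
HWP m n α β = HWPDecomp m n α β

module Submission where

-- Write layer (x , i) = x and call an edge from (x , i) to (x + 1 , j)
-- ascending at (x , i).  A closed walk in C_m[n] projects to a closed walk in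
-- the cycle ℤ_m; if it makes F forward and B backward steps, then F ≡ B
-- (mod m) (the winding lemma).  Two consequences drive the proof:
--  * a closed walk of odd length m is monotone (all steps forward or all
--    backward), so in a C_m-factor each vertex has at most one ascending edge;
--  * a monotone closed walk of length k forces m ∣ k.
-- Every vertex has n ascending edges in C_m[n]; the n − 1 C_m-factors carry at
-- most n − 1 of them, so by pigeonhole the C_n-factor has an ascending edge at
-- every vertex.  Along a cycle of the C_n-factor this forces every forward step
-- to be followed by a forward step, so that cycle is monotone and m ∣ n.

open import Defs
open import Data.Nat using (ℕ; zero; suc; _+_; _*_; _∸_; _≤_; _<_; NonZero; _%_)
open import Data.Nat.Properties
open import Data.Nat.DivMod using (_mod_; %-distribˡ-+; m%n%n≡m%n; [m+kn]%n≡m%n; [m+n]%n≡m%n; m<n⇒m%n≡m; m%n<n)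
open import Data.Nat.Divisibility using (_∣_; divides; m%n≡0⇒n∣m)
open import Data.Fin using (Fin; toℕ) renaming (zero to fzero; _≟_ to _≟ᶠ_; _<_ to _<ᶠ_)
open import Data.Fin.Properties using (toℕ-injective; toℕ-fromℕ<; toℕ<n; pigeonhole; any?)
open import Data.Product using (_×_; ∃; ∃₂; _,_; proj₁; proj₂)
open import Data.Sum using (_⊎_; inj₁; inj₂)
open import Data.Empty using (⊥; ⊥-elim)
open import Function using (_∘_)
open import Relation.Nullary using (¬_; Dec; yes; no; ¬?; contradiction)
open import Relation.Nullary.Decidable using (decidable-stable)
open import Relation.Unary using (Decidable)
open import Relation.Binary.PropositionalEquality
open ≡-Reasoning

%-absorbˡ : ∀ a b M .{{_ : NonZero M}} → (a % M + b) % M ≡ (a + b) % M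
%-absorbˡ a b M = begin
  (a % M + b) % M          ≡⟨ %-distribˡ-+ (a % M) b M ⟩
  (a % M % M + b % M) % M  ≡⟨ cong (λ r → (r + b % M) % M) (m%n%n≡m%n a M) ⟩
  (a % M + b % M) % M      ≡⟨ %-distribˡ-+ a b M ⟨
  (a + b) % M              ∎

%-+-congˡ : ∀ z {x y} M .{{_ : NonZero M}} → x % M ≡ y % M → (z + x) % M ≡ (z + y) % M
%-+-congˡ z {x} {y} M x≡y = begin
  (z + x) % M          ≡⟨ %-distribˡ-+ z x M ⟩
  (z % M + x % M) % M  ≡⟨ cong (λ r → (z % M + r) % M) x≡y ⟩
  (z % M + y % M) % M  ≡⟨ %-distribˡ-+ z y M ⟨
  (z + y) % M          ∎

-- Conversely, a common summand can be cancelled modulo M: add c·(M − 1)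
-- to both sides, turning c into the multiple c·M.
%-cancelˡ : ∀ c a b M' → (c + a) % suc M' ≡ (c + b) % suc M' → a % suc M' ≡ b % suc M'
%-cancelˡ c a b M' ca≡cb = begin
  a % M                   ≡⟨ [m+kn]%n≡m%n a c M ⟨
  (a + c * M) % M         ≡⟨ cong (_% M) (regroup a) ⟩
  (c * M' + (c + a)) % M  ≡⟨ %-+-congˡ (c * M') M ca≡cb ⟩
  (c * M' + (c + b)) % M  ≡⟨ cong (_% M) (regroup b) ⟨
  (b + c * M) % M         ≡⟨ [m+kn]%n≡m%n b c M ⟩
  b % M                   ∎
  where
  M = suc M'
  regroup : ∀ x → x + c * M ≡ c * M' + (c + x)
  regroup x = begin
    x + c * M          ≡⟨ cong (x +_) (*-suc c M') ⟩
    x + (c + c * M')   ≡⟨ +-comm x (c + c * M') ⟩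
    c + c * M' + x     ≡⟨ cong (_+ x) (+-comm c (c * M')) ⟩
    c * M' + c + x     ≡⟨ +-assoc (c * M') c x ⟩
    c * M' + (c + x)   ∎

toℕ-next : ∀ {k} (x : Fin (suc k)) → toℕ (next x) ≡ suc (toℕ x) % suc k
toℕ-next {k} x = toℕ-fromℕ< (m%n<n (suc (toℕ x)) (suc k))

next-injective : ∀ {k} {a b : Fin (suc k)} → next a ≡ next b → a ≡ b
next-injective {k} {a} {b} na≡nb = toℕ-injective (begin
  toℕ a          ≡⟨ m<n⇒m%n≡m (toℕ<n a) ⟨
  toℕ a % suc k  ≡⟨ %-cancelˡ 1 (toℕ a) (toℕ b) k 1+a≡1+b ⟩
  toℕ b % suc k  ≡⟨ m<n⇒m%n≡m (toℕ<n b) ⟩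
  toℕ b          ∎)
  where
  1+a≡1+b : suc (toℕ a) % suc k ≡ suc (toℕ b) % suc k
  1+a≡1+b = trans (sym (toℕ-next a)) (trans (cong toℕ na≡nb) (toℕ-next b))

_↗_ : ∀ {k} → Fin k → Fin k → Set
x ↗ y = y ≡ next x

↗-asym : ∀ {k} → 3 ≤ suc k → {x y : Fin (suc k)} → x ↗ y → y ↗ x → ⊥
↗-asym {k} 3≤K {x} {y} x↗y y↗x = 1+n≢0 (begin
  2              ≡⟨ m<n⇒m%n≡m 3≤K ⟨
  2 % K          ≡⟨ %-cancelˡ (toℕ x) 2 0 k two-steps ⟩
  0              ∎)
  where
  K = suc k
  two-steps : (toℕ x + 2) % K ≡ (toℕ x + 0) % K
  two-steps = begin
    (toℕ x + 2) % K             ≡⟨ cong (_% K) (+-comm (toℕ x) 2) ⟩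
    (1 + suc (toℕ x)) % K       ≡⟨ %-+-congˡ 1 K (m%n%n≡m%n (suc (toℕ x)) K) ⟨
    suc (suc (toℕ x) % K) % K   ≡⟨ cong (λ r → suc r % K) (toℕ-next x) ⟨
    suc (toℕ (next x)) % K      ≡⟨ toℕ-next (next x) ⟨
    toℕ (next (next x))         ≡⟨ cong toℕ (trans (cong next (sym x↗y)) (sym y↗x)) ⟩
    toℕ x                       ≡⟨ m<n⇒m%n≡m (toℕ<n x) ⟨
    toℕ x % K                   ≡⟨ cong (_% K) (+-identityʳ (toℕ x)) ⟨
    (toℕ x + 0) % K             ∎

-- Position j mod K on a cycle of length K = k + 1, used to read a cycle
-- Fin K → W as a periodic sequence ℕ → W.
pos : ∀ {k} → ℕ → Fin (suc k)
pos {k} j = j mod suc k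

toℕ-pos : ∀ {k} j → toℕ (pos {k} j) ≡ j % suc k
toℕ-pos {k} j = toℕ-fromℕ< (m%n<n j (suc k))

next-pos : ∀ {k} j → next (pos {k} j) ≡ pos (suc j)
next-pos {k} j = toℕ-injective (begin
  toℕ (next (pos j))     ≡⟨ toℕ-next (pos j) ⟩
  suc (toℕ (pos j)) % K  ≡⟨ cong (λ r → suc r % K) (toℕ-pos j) ⟩
  (1 + j % K) % K        ≡⟨ %-+-congˡ 1 K (m%n%n≡m%n j K) ⟩
  suc j % K              ≡⟨ toℕ-pos (suc j) ⟨
  toℕ (pos (suc j))      ∎)
  where K = suc k

pos-toℕ : ∀ {k} (i : Fin (suc k)) → pos (toℕ i) ≡ i
pos-toℕ i = toℕ-injective (trans (toℕ-pos (toℕ i)) (m<n⇒m%n≡m (toℕ<n i)))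

pos-suc-toℕ : ∀ {k} (i : Fin (suc k)) → pos (suc (toℕ i)) ≡ next i
pos-suc-toℕ i = trans (sym (next-pos (toℕ i))) (cong next (pos-toℕ i))

pos-periodic : ∀ {k} j → pos {k} (j + suc k) ≡ pos j
pos-periodic {k} j = toℕ-injective (begin
  toℕ (pos (j + suc k))  ≡⟨ toℕ-pos (j + suc k) ⟩
  (j + suc k) % suc k    ≡⟨ [m+n]%n≡m%n j (suc k) ⟩
  j % suc k              ≡⟨ toℕ-pos j ⟨
  toℕ (pos j)            ∎)

count : ∀ {P : ℕ → Set} → Decidable P → ℕ → ℕ
count P? zero = 0
count P? (suc k) with P? k
... | yes _ = suc (count P? k)
... | no _  = count P? k

count-complement : ∀ {P : ℕ → Set} (P? : Decidable P) k → count P? k + count (¬? ∘ P?) k ≡ k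
count-complement P? zero = refl
count-complement P? (suc k) with P? k
... | yes _ = cong suc (count-complement P? k)
... | no _  = trans (+-suc (count P? k) _) (cong suc (count-complement P? k))

count≡0⇒none : ∀ {P : ℕ → Set} (P? : Decidable P) k → count P? k ≡ 0 → ∀ j → j < k → ¬ P j
count≡0⇒none P? (suc k) count≡0 j j<1+k with P? k | m<1+n⇒m<n∨m≡n j<1+k
... | yes _  | _         = contradiction count≡0 1+n≢0
... | no _   | inj₁ j<k  = count≡0⇒none P? k count≡0 j j<k
... | no ¬pk | inj₂ refl = ¬pk

none⇒count≡0 : ∀ {P : ℕ → Set} (P? : Decidable P) k → (∀ j → j < k → ¬ P j) → count P? k ≡ 0
none⇒count≡0 P? zero _ = refl
none⇒count≡0 P? (suc k) none with P? k
... | yes pk = contradiction pk (none k (n<1+n k))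
... | no _   = none⇒count≡0 P? k (λ j j<k → none j (m<n⇒m<1+n j<k))

IsWalk : ∀ {M} → (ℕ → Fin M) → Set
IsWalk ℓ = ∀ j → ℓ j ↗ ℓ (suc j) ⊎ ℓ (suc j) ↗ ℓ j

module Winding {m'} (ℓ : ℕ → Fin (suc m')) (walk : IsWalk ℓ) where

  Forward : ℕ → Set
  Forward j = ℓ j ↗ ℓ (suc j)

  forward? : Decidable Forward
  forward? j = ℓ (suc j) ≟ᶠ next (ℓ j)

  backward : ∀ j → ¬ Forward j → ℓ (suc j) ↗ ℓ j
  backward j ¬fwd with walk j
  ... | inj₁ fwd = contradiction fwd ¬fwd
  ... | inj₂ bwd = bwd

  F B : ℕ → ℕ
  F = count forward?
  B = count (¬? ∘ forward?)

  steps : ∀ K → F K + B K ≡ K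
  steps = count-complement forward?

  private
    M = suc m'
    L : ℕ → ℕ
    L j = toℕ (ℓ j)

  winding : ∀ j → (L j + B j) % M ≡ (L 0 + F j) % M
  winding zero = refl
  winding (suc j) with forward? j
  ... | yes fwd = begin
    (L (suc j) + B j) % M         ≡⟨ cong (λ r → (toℕ r + B j) % M) fwd ⟩
    (toℕ (next (ℓ j)) + B j) % M  ≡⟨ cong (λ r → (r + B j) % M) (toℕ-next (ℓ j)) ⟩
    (suc (L j) % M + B j) % M     ≡⟨ %-absorbˡ (suc (L j)) (B j) M ⟩
    (1 + (L j + B j)) % M         ≡⟨ %-+-congˡ 1 M (winding j) ⟩
    (1 + (L 0 + F j)) % M         ≡⟨ cong (_% M) (+-suc (L 0) (F j)) ⟨
    (L 0 + suc (F j)) % M         ∎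
  ... | no ¬fwd = begin
    (L (suc j) + suc (B j)) % M          ≡⟨ cong (_% M) (+-suc (L (suc j)) (B j)) ⟩
    (suc (L (suc j)) + B j) % M          ≡⟨ %-absorbˡ (suc (L (suc j))) (B j) M ⟨
    (suc (L (suc j)) % M + B j) % M      ≡⟨ cong (λ r → (r + B j) % M) (toℕ-next (ℓ (suc j))) ⟨
    (toℕ (next (ℓ (suc j))) + B j) % M   ≡⟨ cong (λ r → (toℕ r + B j) % M) (backward j ¬fwd) ⟨
    (L j + B j) % M                      ≡⟨ winding j ⟩
    (L 0 + F j) % M                      ∎

  balance : ∀ K → ℓ K ≡ ℓ 0 → B K % M ≡ F K % M
  balance K closed = %-cancelˡ (L 0) (B K) (F K) m' (begin
    (L 0 + B K) % M  ≡⟨ cong (λ r → (toℕ r + B K) % M) closed ⟨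
    (L K + B K) % M  ≡⟨ winding K ⟩
    (L 0 + F K) % M  ∎)

  monotone⇒∣ : ∀ K → ℓ K ≡ ℓ 0 → B K ≡ 0 ⊎ F K ≡ 0 → M ∣ K
  monotone⇒∣ K closed (inj₁ B≡0) = m%n≡0⇒n∣m K M (begin
    K % M            ≡⟨ cong (_% M) (steps K) ⟨
    (F K + B K) % M  ≡⟨ cong (λ b → (F K + b) % M) B≡0 ⟩
    (F K + 0) % M    ≡⟨ cong (_% M) (+-identityʳ (F K)) ⟩
    F K % M          ≡⟨ balance K closed ⟨
    B K % M          ≡⟨ cong (_% M) B≡0 ⟩
    0                ∎)
  monotone⇒∣ K closed (inj₂ F≡0) = m%n≡0⇒n∣m K M (begin
    K % M            ≡⟨ cong (_% M) (steps K) ⟨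
    (F K + B K) % M  ≡⟨ cong (λ f → (f + B K) % M) F≡0 ⟩
    B K % M          ≡⟨ balance K closed ⟩
    F K % M          ≡⟨ cong (_% M) F≡0 ⟩
    0                ∎)

  -- A closed walk of odd length M is monotone: if F, B < M then F = B by
  -- balance and M = F + B would be even.
  odd⇒monotone : ¬ 2 ∣ M → ℓ M ≡ ℓ 0 → B M ≡ 0 ⊎ F M ≡ 0
  odd⇒monotone odd closed
    with m≤n⇒m<n∨m≡n (subst (B M ≤_) (steps M) (m≤n+m (B M) (F M)))
       | m≤n⇒m<n∨m≡n (subst (F M ≤_) (steps M) (m≤m+n (F M) (B M)))
  ... | inj₂ B≡M | _        = inj₂ (+-cancelʳ-≡ (B M) (F M) 0 (trans (steps M) (sym B≡M)))
  ... | inj₁ _   | inj₂ F≡M = inj₁ (+-cancelˡ-≡ (F M) (B M) 0 (trans (steps M) (trans (sym F≡M) (sym (+-identityʳ (F M))))))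
  ... | inj₁ B<M | inj₁ F<M = contradiction (divides (F M) M≡F*2) odd
    where
    B≡F : B M ≡ F M
    B≡F = trans (sym (m<n⇒m%n≡m B<M)) (trans (balance M closed) (m<n⇒m%n≡m F<M))
    M≡F*2 : M ≡ F M * 2
    M≡F*2 = begin
      M            ≡⟨ steps M ⟨
      F M + B M    ≡⟨ cong (F M +_) B≡F ⟩
      F M + F M    ≡⟨ cong (F M +_) (*-identityʳ (F M)) ⟨
      F M + F M * 1 ≡⟨ *-suc (F M) 1 ⟨
      F M * 2      ∎

layer : ∀ {m n} → V m n → Fin m
layer = proj₁

IsClosedWalk : ∀ {m n k} → (Fin (suc k) → V m n) → Set
IsClosedWalk {m} {n} c = ∀ i → Adj m n (c i) (c (next i))

layers : ∀ {m n k} → (Fin (suc k) → V m n) → ℕ → Fin m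
layers c j = layer (c (pos j))

layers-walk : ∀ {m' n k} (c : Fin (suc k) → V (suc m') n) → IsClosedWalk c → IsWalk (layers c)
layers-walk c closedWalk j = subst (λ q → Adj _ _ (c (pos j)) (c q)) (next-pos j) (closedWalk (pos j))

layers-periodic : ∀ {m n k} (c : Fin (suc k) → V m n) j → layers c (j + suc k) ≡ layers c j
layers-periodic c j = cong (layer ∘ c) (pos-periodic j)

at-index : ∀ {m n k} (R : Fin m → Fin m → Set) (c : Fin (suc k) → V m n) (i : Fin (suc k)) →
           R (layers c (toℕ i)) (layers c (suc (toℕ i))) → R (layer (c i)) (layer (c (next i)))
at-index R c i = subst₂ (λ a b → R (layer (c a)) (layer (c b))) (pos-toℕ i) (pos-suc-toℕ i)

module CycleNeighbours {k W} (Φ : CycleFactor (suc k) W) (p : Fin (CycleFactor.t Φ)) where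
  open CycleFactor Φ

  vertex : ℕ → W
  vertex j = cyc p (pos j)

  neighbours : ∀ j {u} → FEdge Φ (vertex (suc j)) u → u ≡ vertex (suc (suc j)) ⊎ u ≡ vertex j
  neighbours j (p' , i , inj₁ (ci≡w , cn≡u)) with disj p' p i (pos (suc j)) ci≡w
  ... | refl = inj₁ (trans (sym cn≡u) (cong (cyc p) (trans (cong next (inj p ci≡w)) (next-pos (suc j)))))
  neighbours j (p' , i , inj₂ (ci≡u , cn≡w)) with disj p' p (next i) (pos (suc j)) cn≡w
  ... | refl = inj₂ (trans (sym ci≡u) (cong (cyc p) (next-injective (trans (inj p cn≡w) (sym (next-pos j))))))

module OddFactor {m' N} (3≤M : 3 ≤ suc m') (odd : ¬ 2 ∣ suc m')
                 (Φ : CycleFactor (suc m') (V (suc m') N))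
                 (sub : ∀ u v → FEdge Φ u v → Adj (suc m') N u v) where
  open CycleFactor Φ

  Ascending Descending : Fin t → Set
  Ascending p  = ∀ i → layer (cyc p i) ↗ layer (cyc p (next i))
  Descending p = ∀ i → layer (cyc p (next i)) ↗ layer (cyc p i)

  -- Each cycle is a closed walk of odd length M, hence monotone.
  cycle-monotone : ∀ p → Ascending p ⊎ Descending p
  cycle-monotone p = monotone (odd⇒monotone odd (layers-periodic (cyc p) 0))
    where
    open Winding (layers (cyc p)) (layers-walk (cyc p) (λ i → sub _ _ (p , i , inj₁ (refl , refl))))
    monotone : B (suc m') ≡ 0 ⊎ F (suc m') ≡ 0 → Ascending p ⊎ Descending p
    monotone (inj₁ B≡0) = inj₁ λ i → at-index _↗_ (cyc p) i
      (decidable-stable (forward? (toℕ i)) (count≡0⇒none (¬? ∘ forward?) _ B≡0 (toℕ i) (toℕ<n i)))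
    monotone (inj₂ F≡0) = inj₂ λ i → at-index (λ a b → b ↗ a) (cyc p) i
      (backward (toℕ i) (count≡0⇒none forward? _ F≡0 (toℕ i) (toℕ<n i)))

  data AscendingEdge (v u : V (suc m') N) : Set where
    along   : ∀ p i → cyc p i ≡ v → cyc p (next i) ≡ u → Ascending p → AscendingEdge v u
    against : ∀ p i → cyc p i ≡ u → cyc p (next i) ≡ v → Descending p → AscendingEdge v u

  -- Along an ascending cycle the edge is traversed upwards, along a
  -- descending one downwards; the other orientations contradict ↗-asym.
  orient : ∀ {v u} → layer v ↗ layer u → FEdge Φ v u → AscendingEdge v u
  orient v↗u (p , i , edge) with cycle-monotone p | edge
  ... | inj₁ asc  | inj₁ (ci≡v , cn≡u) = along p i ci≡v cn≡u asc
  ... | inj₁ asc  | inj₂ (ci≡u , cn≡v) =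
    ⊥-elim (↗-asym 3≤M v↗u (subst₂ _↗_ (cong layer ci≡u) (cong layer cn≡v) (asc i)))
  ... | inj₂ desc | inj₁ (ci≡v , cn≡u) =
    ⊥-elim (↗-asym 3≤M v↗u (subst₂ (λ a b → b ↗ a) (cong layer ci≡v) (cong layer cn≡u) (desc i)))
  ... | inj₂ desc | inj₂ (ci≡u , cn≡v) = against p i ci≡u cn≡v desc

  -- (Here 3 ≤ M is needed: on a 2-cycle both would hold.)
  not-both : ∀ p i → Ascending p → Descending p → ⊥
  not-both p i asc desc = ↗-asym 3≤M (asc i) (desc i)

  -- Two ascending edges at v lie on v's unique cycle, in the same direction,
  -- so injectivity of the cycle makes their endpoints equal.
  same-endpoint : ∀ {v u u'} → AscendingEdge v u → AscendingEdge v u' → u ≡ u'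
  same-endpoint (along p i ci≡v cn≡u _) (along p' i' ci'≡v cn'≡u' _)
    with disj p p' i i' (trans ci≡v (sym ci'≡v))
  ... | refl = trans (sym cn≡u) (trans (cong (cyc p ∘ next) (inj p (trans ci≡v (sym ci'≡v)))) cn'≡u')
  same-endpoint (against p i ci≡u cn≡v _) (against p' i' ci'≡u' cn'≡v _)
    with disj p p' (next i) (next i') (trans cn≡v (sym cn'≡v))
  ... | refl = trans (sym ci≡u) (trans (cong (cyc p) (next-injective (inj p (trans cn≡v (sym cn'≡v))))) ci'≡u')
  same-endpoint (along p i ci≡v _ asc) (against p' i' _ cn'≡v desc)
    with disj p p' i (next i') (trans ci≡v (sym cn'≡v))
  ... | refl = ⊥-elim (not-both p i asc desc)
  same-endpoint (against p i _ cn≡v desc) (along p' i' ci'≡v _ asc)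
    with disj p p' (next i) i' (trans cn≡v (sym ci'≡v))
  ... | refl = ⊥-elim (not-both p i asc desc)

  ascending-neighbour-unique : ∀ {v u u'} → layer v ↗ layer u → layer v ↗ layer u' →
                               FEdge Φ v u → FEdge Φ v u' → u ≡ u'
  ascending-neighbour-unique v↗u v↗u' e e' = same-endpoint (orient v↗u e) (orient v↗u' e')

pigeonhole-⊎ : ∀ {k} {R : Set} (box : Fin (suc k) → Fin k ⊎ R) →
               (∀ i j {a} → box i ≡ inj₁ a → box j ≡ inj₁ a → i ≡ j) →
               ∃₂ λ j r → box j ≡ inj₂ r
pigeonhole-⊎ {k} {R} box left-injective with any? (λ j → right? (box j))
  where
  right? : (s : Fin k ⊎ R) → Dec (∃ λ r → s ≡ inj₂ r)
  right? (inj₁ _) = no λ { (_ , ()) }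
  right? (inj₂ r) = yes (r , refl)
... | yes found = found
... | no none   = contradiction (pigeonhole (n<1+n k) leftBox) distinct
  where
  left : (s : Fin k ⊎ R) → ¬ (∃ λ r → s ≡ inj₂ r) → ∃ λ a → s ≡ inj₁ a
  left (inj₁ a) _  = a , refl
  left (inj₂ r) ¬r = contradiction (r , refl) ¬r
  inLeft : ∀ j → ∃ λ a → box j ≡ inj₁ a
  inLeft j = left (box j) (λ r → none (j , r))
  leftBox : Fin (suc k) → Fin k
  leftBox j = proj₁ (inLeft j)
  distinct : ¬ ∃₂ λ i j → i <ᶠ j × leftBox i ≡ leftBox j
  distinct (i , j , i<j , same) =
    <-irrefl (cong toℕ (left-injective i j (proj₂ (inLeft i)) (trans (proj₂ (inLeft j)) (cong inj₁ (sym same))))) i<j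

module NoDecomposition {m' n'} (3≤M : 3 ≤ suc m') (odd : ¬ 2 ∣ suc m')
                       (D : HWP (suc m') (suc n') n' 1) where
  open HWPDecomp D

  -- The N ascending edges at v lie in distinct C_M-factors, so one of them
  -- lies in the C_N-factor.
  ascending-in-Cn : ∀ v → ∃ λ u → layer v ↗ layer u × FEdge (Fn fzero) v u
  ascending-in-Cn v = use (pigeonhole-⊎ factorOf distinct)
    where
    up : Fin (suc n') → V (suc m') (suc n')
    up j = next (layer v) , j
    factorOf : Fin (suc n') → Fin n' ⊎ Fin 1
    factorOf j = proj₁ (exactlyOne v (up j) (inj₁ refl))
    inFactor : ∀ j {f} → factorOf j ≡ f → InF Fm Fn f v (up j)
    inFactor j refl = proj₁ (proj₂ (exactlyOne v (up j) (inj₁ refl)))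
    distinct : ∀ i j {a} → factorOf i ≡ inj₁ a → factorOf j ≡ inj₁ a → i ≡ j
    distinct i j {a} fi fj = cong proj₂
      (OddFactor.ascending-neighbour-unique 3≤M odd (Fm a) (sub (inj₁ a)) refl refl (inFactor i fi) (inFactor j fj))
    use : (∃₂ λ j r → factorOf j ≡ inj₂ r) → ∃ λ u → layer v ↗ layer u × FEdge (Fn fzero) v u
    use (j , fzero , fj) = up j , refl , inFactor j fj

  open CycleFactor (Fn fzero)

  p₀ : Fin t
  p₀ = proj₁ (cover (fzero , fzero))

  closedWalk : IsClosedWalk (cyc p₀)
  closedWalk i = sub (inj₂ fzero) _ _ (p₀ , i , inj₁ (refl , refl))

  open Winding (layers (cyc p₀)) (layers-walk (cyc p₀) closedWalk)
  open CycleNeighbours (Fn fzero) p₀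

  -- After a forward step the ascending edge of the C_N-factor at the next
  -- vertex must continue along the cycle: going back would be a descent.
  forward-persists : ∀ j → Forward j → Forward (suc j)
  forward-persists j fwd with ascending-in-Cn (vertex (suc j))
  ... | u , up , edge with neighbours j edge
  ...   | inj₁ u≡next = subst (λ x → layers (cyc p₀) (suc j) ↗ layer x) u≡next up
  ...   | inj₂ u≡prev = ⊥-elim (↗-asym 3≤M fwd (subst (λ x → layers (cyc p₀) (suc j) ↗ layer x) u≡prev up))

  forward-later : ∀ d {j} → Forward j → Forward (d + j)
  forward-later zero    fwd = fwd
  forward-later (suc d) fwd = forward-persists _ (forward-later d fwd)

  forward-periodic : Forward (suc n') → Forward 0
  forward-periodic = subst₂ _↗_ (layers-periodic (cyc p₀) 0) (layers-periodic (cyc p₀) 1)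

  -- Hence the cycle is monotone: all forward if its first step is, otherwise
  -- no forward step at all (one would propagate round to step 0).
  monotone : B (suc n') ≡ 0 ⊎ F (suc n') ≡ 0
  monotone with forward? 0
  ... | yes fwd₀ = inj₁ (none⇒count≡0 (¬? ∘ forward?) _
          (λ j _ ¬fwd → ¬fwd (subst Forward (+-identityʳ j) (forward-later j fwd₀))))
  ... | no ¬fwd₀ = inj₂ (none⇒count≡0 forward? _
          (λ j j<N fwd → ¬fwd₀ (forward-periodic (subst Forward (m∸n+n≡m (<⇒≤ j<N)) (forward-later (suc n' ∸ j) fwd)))))

  M∣N : suc m' ∣ suc n'
  M∣N = monotone⇒∣ (suc n') (layers-periodic (cyc p₀) 0) monotone

-- The theorem: a decomposition would give m ∣ n (only n ≥ 1 is used).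
theorem3p3 : (m n : ℕ) → 3 ≤ m → ¬ (2 ∣ m) → 3 ≤ n → ¬ (m ∣ n) →
    ¬ HWP m n (n ∸ 1) 1
theorem3p3 (suc m') (suc n') 3≤m odd _ m∤n D = m∤n (NoDecomposition.M∣N 3≤m odd D)
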